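{- Let $p=\underline{p_1p_2\cdots p_\ell}$ be a consecutive pattern with minimal extendable index $i$, and let $\Delta_1^1,\ldots,\Delta_{\ell-i+2}^1$ be as defined below. If exactly one of the numbers $\Delta_1^1,\Delta_2^1,\ldots,\Delta_{\ell-i+2}^1$ is positive, then the property "to have two occurrences of $p$" is unstable, i.e., there exist $n$, $(k_1,\ldots,k_n)\in\mathbb N^n$ and $\tau\in\mathfrak S_n$ with $|M(k_1,\ldots,k_n)^*(p;2)|\ne|M(k_{\tau^{ -1}(1)},\ldots,k_{\tau^{ -1}(n)})^*(p;2)|$.
   Context: $M(k_1,\ldots,k_n)$ is the multiset containing the letter $j$ exactly $k_j$ times; a permutation of it is a word in which each letter $j$ occurs exactly $k_j$ times. A consecutive pattern $p=\underline{p_1\cdots p_\ell}$ is a permutation $p_1\cdots p_\ell$ of $\{1,\ldots,\ell\}$; a factor $\pi_a\cdots\pi_{a+\ell-1}$ of a word forms an occurrence of $p$ if for all $j,k$, $\pi_{a+j-1}<\pi_{a+k-1}$ iff $p_j<p_k$. $M^*(p;s)$ is the set of permutations of $M$ with exactly $s$ occurrences of $p$. An index $i$ with $2\le i\le\ell$ is extendable if there is a word $\pi_1\cdots\pi_{\ell+i-1}$ over positive integers whose first $\ell$ letters and whose last $\ell$ letters each form an occurrence of $p$; the minimal extendable index is the smallest such $i$. Let $\sigma\in\mathfrak S_{\ell-i+1}$ satisfy $p_{\sigma(1)}<\cdots<p_{\sigma(\ell-i+1)}$. Set $\delta_1^1:=p_{\sigma(1)}-1$, $\delta_1^2:=p_{\sigma(1)+i-1}-1$,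 $\delta_{\ell-i+2}^1:=\ell-p_{\sigma(\ell-i+1)}$, $\delta_{\ell-i+2}^2:=\ell-p_{\sigma(\ell-i+1)+i-1}$, and for $2\le j\le\ell-i+1$: $\delta_j^1:=p_{\sigma(j)}-p_{\sigma(j-1)}-1$, $\delta_j^2:=p_{\sigma(j)+i-1}-p_{\sigma(j-1)+i-1}-1$; finally $\Delta_j^1:=\min\{\delta_j^1,\delta_j^2\}$ and $\Delta_j^2:=|\delta_j^1-\delta_j^2|$ for $1\le j\le\ell-i+2$. -}

module Defs where

open import Data.Nat using (ℕ; zero; suc; _+_; _∸_; _<_; _≤_; _<ᵇ_; _≡ᵇ_; _<?_)
open import Data.Bool using (Bool; true; false; _∧_; if_then_else_)
open import Data.Bool.Properties using () renaming (_≟_ to _≟ᵇ_)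
open import Data.List using (List; []; _∷_; length; map; upTo; take; drop; filterᵇ; concatMap; allFin)
open import Data.Bool.ListAction using (all)
open import Data.Nat.ListAction using (sum)
open import Data.List.Relation.Unary.All using (All)
open import Data.Fin using (Fin; toℕ; fromℕ<)
open import Data.Fin.Permutation using (Permutation′; _⟨$⟩ʳ_)
open import Data.Integer as ℤ using (ℤ; +_; _-_; _⊓_)
open import Data.Product using (Σ; _×_; ∃)
open import Relation.Binary.PropositionalEquality using (_≡_; _≢_)
open import Relation.Nullary using (¬_; yes; no)

-- 1-indexed lookup in a list (0 outside the valid range).
at : List ℕ → ℕ → ℕ
at [] _ = 0
at (x ∷ xs) zero = 0
at (x ∷ xs) (suc zero) = x
at (x ∷ xs) (suc (suc j)) = at xs (suc j)

_==_ : Bool → Bool → Bool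
true == b = b
false == true = false
false == false = true

isOcc : List ℕ → List ℕ → Bool
isOcc p w =
  (length w ≡ᵇ length p) ∧
  all (λ j → all (λ k → ((at w j <ᵇ at w k) == (at p j <ᵇ at p k)))
                 (map suc (upTo (length p))))
      (map suc (upTo (length p)))

occurrences : List ℕ → List ℕ → ℕ
occurrences p π =
  length (filterᵇ (λ a → isOcc p (take (length p) (drop a π))) (upTo (length π)))

Extendable : List ℕ → ℕ → Set
Extendable p i =
  2 ≤ i × i ≤ length p ×
  Σ (List ℕ) λ w → length w ≡ length p + i ∸ 1 × All (0 <_) w ×
    isOcc p (take (length p) w) ≡ true × isOcc p (drop (i ∸ 1) w) ≡ true

MinExtendable : List ℕ → ℕ → Set
MinExtendable p i = Extendable p i × (∀ j → Extendable p j → i ≤ j)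

-- σ as a map on 1-indexed positions {1,…,m} (0 outside).
σℕ : ∀ {m} → Permutation′ m → ℕ → ℕ
σℕ {m} σ zero = 0
σℕ {m} σ (suc j) with j <? m
... | yes h = suc (toℕ (σ ⟨$⟩ʳ fromℕ< h))
... | no _ = 0

Sorts : (p : List ℕ) (i : ℕ) → Permutation′ (length p ∸ i + 1) → Set
Sorts p i σ = ∀ (a b : ℕ) → 1 ≤ a → a < b → b ≤ length p ∸ i + 1 →
  at p (σℕ σ a) < at p (σℕ σ b)

δ : (p : List ℕ) (i : ℕ) → Permutation′ (length p ∸ i + 1) → (shift : ℕ) → ℕ → ℤ
δ p i σ s j =
  let m = length p ∸ i + 1
      P : ℕ → ℤ
      P a = + at p (a + s)
  in if j ≡ᵇ 1 then P (σℕ σ 1) - + 1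
     else if j ≡ᵇ (m + 1) then + length p - P (σℕ σ m)
     else P (σℕ σ j) - P (σℕ σ (j ∸ 1)) - + 1

δ¹ δ² : (p : List ℕ) (i : ℕ) → Permutation′ (length p ∸ i + 1) → ℕ → ℤ
δ¹ p i σ = δ p i σ 0
δ² p i σ = δ p i σ (i ∸ 1)

Δ¹ : (p : List ℕ) (i : ℕ) → Permutation′ (length p ∸ i + 1) → ℕ → ℤ
Δ¹ p i σ j = δ¹ p i σ j ⊓ δ² p i σ j

ExactlyOnePositive : (p : List ℕ) (i : ℕ) → Permutation′ (length p ∸ i + 1) → Set
ExactlyOnePositive p i σ =
  Σ ℕ λ j → 1 ≤ j × j ≤ length p ∸ i + 2 × ℤ.0ℤ ℤ.< Δ¹ p i σ j ×
    (∀ j′ → 1 ≤ j′ → j′ ≤ length p ∸ i + 2 → j′ ≢ j → ¬ (ℤ.0ℤ ℤ.< Δ¹ p i σ j′))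

words : ℕ → ℕ → List (List ℕ)
words n zero = [] ∷ []
words n (suc N) = concatMap (λ a → map (a ∷_) (words n N)) (map (λ j → suc (toℕ j)) (allFin n))

count : ℕ → List ℕ → ℕ
count x w = length (filterᵇ (λ y → y ≡ᵇ x) w)

-- w is a permutation of M(k_1,…,k_n): letter j occurs exactly k_j times
-- (w is drawn from words over {1,…,n} of length k_1+⋯+k_n).
isPermOfM : ∀ {n} → (Fin n → ℕ) → List ℕ → Bool
isPermOfM {n} k w = all (λ j → count (suc (toℕ j)) w ≡ᵇ k j) (allFin n)

cardMstar : ∀ {n} → (Fin n → ℕ) → List ℕ → ℕ → ℕ
cardMstar {n} k p s =
  length (filterᵇ (λ w → isPermOfM k w ∧ (occurrences p w ≡ᵇ s))
                  (words n (sum (map k (allFin n)))))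

-- Write s = i − 1 and m = ℓ − i + 1. By minimality of i, a word of length ℓ + s with two
-- occurrences of p has them at positions 1 and s + 1, overlapping in m letters, and a letter
-- repeated in such a word occurs once among its first s and once among its last s letters. If the
-- repeated letter is the smallest one, both occurrences see the value 1 of p outside their common
-- part, which forces Δ_1^1 > 0; if it is the largest one, Δ_{ℓ−i+2}^1 > 0. Conversely, Δ_j^1 > 0
-- yields, in a word witnessing extendability, a letter among the first s and one among the last s
-- lying in the same gap between the shared values; shifting the values of that gap differently on
-- the two sides makes the two letters equal without changing either occurrence. For the multiset M
-- of the resulting word, trading the multiplicity of the repeated letter with that of the letter 1
-- (or of the largest letter when Δ_1^1 is the positive one) gives a multiset none of whose
-- permutations has two occurrences of p, while M has one.

module Submission where

open import Defs
open import Data.Nat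
open import Data.Nat.Properties
open import Data.Nat.ListAction using (sum)
open import Data.Integer as ℤ using (0ℤ; +<+)
import Data.Integer.Properties as ℤ
open import Data.Bool using (Bool; true; false; T; _∧_; if_then_else_)
open import Data.Bool.Properties using (T-∧; T-≡)
open import Data.Bool.ListAction using (all)
open import Data.List using (List; []; _∷_; length; map; upTo; applyUpTo; take; drop; _++_; filterᵇ; allFin; tabulate)
open import Data.List.Properties using (length-take; length-drop; length-map; take-all; take-take; take-drop; drop-drop; length-upTo; filter-none; map-tabulate)
open import Data.List.Extrema.Nat using (max; xs≤max)
open import Data.List.Relation.Unary.All as All using (All; []; _∷_)
import Data.List.Relation.Unary.All.Properties as All
open import Data.List.Relation.Unary.Any using (here; there)
open import Data.List.Relation.Unary.Unique.Propositional using (Unique; []; _∷_)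
import Data.List.Relation.Unary.Unique.Propositional.Properties as Unique
open import Data.List.Membership.Propositional using (_∈_; find; lose)
open import Data.List.Membership.Propositional.Properties using (∈-map⁺; ∈-map⁻; ∈-concatMap⁺; ∈-concatMap⁻; ∈-allFin; ∈-filter⁺; ∈-length; ∈-upTo⁺; ∈-upTo⁻)
open import Data.List.Relation.Binary.Permutation.Propositional using (_↭_; ↭-sym; ↭⇒↭ₛ)
open import Data.List.Relation.Binary.Permutation.Propositional.Properties using (∈-resp-↭)
import Data.List.Relation.Binary.Permutation.Setoid.Properties as ↭ₛ
open import Data.Fin as Fin using (Fin; zero; suc; toℕ; fromℕ<)
open import Data.Fin.Properties using (toℕ<n; toℕ-fromℕ<; fromℕ<-toℕ)
open import Data.Fin.Permutation using (Permutation′; _⟨$⟩ʳ_; _⟨$⟩ˡ_; inverseʳ; flip; transpose)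
open import Data.Product using (Σ; _×_; _,_; proj₁; proj₂; ∃-syntax; ∃₂)
open import Data.Sum as Sum using (_⊎_; inj₁; inj₂; [_,_]′)
open import Data.Empty using (⊥-elim)
open import Data.Unit using (tt)
open import Function using (_∘_; _⇔_; mk⇔; Equivalence)
open import Function.Construct.Composition using (_⇔-∘_)
open import Relation.Binary.PropositionalEquality
open import Relation.Binary.Definitions using (tri<; tri≈; tri>)
open import Relation.Nullary using (¬_; yes; no; contradiction)
open import Relation.Nullary.Decidable using (T?; dec-true; dec-false)
open import Relation.Nullary.Reflects using (ofʸ; ofⁿ)
import Algebra.Properties.CommutativeMonoid.Sum +-0-commutativeMonoid as FinSum

open Equivalence using (to; from)

-- `at` is 1-indexed; `xs ! j` is its 0-indexed version (0 when j is out of range).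
infixl 9 _!_

_!_ : List ℕ → ℕ → ℕ
xs ! j = at xs (suc j)

!-drop : ∀ (xs : List ℕ) a j → drop a xs ! j ≡ xs ! (a + j)
!-drop xs       zero    j = refl
!-drop []       (suc a) j = refl
!-drop (x ∷ xs) (suc a) j = !-drop xs a j

!-take : ∀ (xs : List ℕ) {n j} → j < n → take n xs ! j ≡ xs ! j
!-take []       {suc n}         _         = refl
!-take (x ∷ xs) {suc n} {zero}  _         = refl
!-take (x ∷ xs) {suc n} {suc j} (s≤s j<n) = !-take xs j<n

!-map : ∀ (f : ℕ → ℕ) (xs : List ℕ) {j} → j < length xs → map f xs ! j ≡ f (xs ! j)
!-map f (x ∷ xs) {zero}  _         = refl
!-map f (x ∷ xs) {suc j} (s≤s j<n) = !-map f xs j<n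

!-++ˡ : ∀ (xs ys : List ℕ) {j} → j < length xs → (xs ++ ys) ! j ≡ xs ! j
!-++ˡ (x ∷ xs) ys {zero}  _         = refl
!-++ˡ (x ∷ xs) ys {suc j} (s≤s j<n) = !-++ˡ xs ys j<n

!-++ʳ : ∀ (xs ys : List ℕ) j → (xs ++ ys) ! (length xs + j) ≡ ys ! j
!-++ʳ []       ys j = refl
!-++ʳ (x ∷ xs) ys j = !-++ʳ xs ys j

!-applyUpTo : ∀ (f : ℕ → ℕ) {n j} → j < n → applyUpTo f n ! j ≡ f j
!-applyUpTo f {suc n} {zero}  _         = refl
!-applyUpTo f {suc n} {suc j} (s≤s j<n) = !-applyUpTo (f ∘ suc) j<n

!-upTo : ∀ n {j} → j < length (upTo n) → upTo n ! j ≡ j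
!-upTo n {j} j<n = !-applyUpTo (λ j → j) (subst (j <_) (length-upTo n) j<n)

!-∈ : ∀ (xs : List ℕ) {j} → j < length xs → xs ! j ∈ xs
!-∈ (x ∷ xs) {zero}  _         = here refl
!-∈ (x ∷ xs) {suc j} (s≤s j<n) = there (!-∈ xs j<n)

∈⇒! : ∀ {xs : List ℕ} {x} → x ∈ xs → ∃[ j ] j < length xs × xs ! j ≡ x
∈⇒! (here refl) = zero , s≤s z≤n , refl
∈⇒! (there x∈xs) with j , j<n , eq ← ∈⇒! x∈xs = suc j , s≤s j<n , eq

All-! : ∀ {P : ℕ → Set} {xs : List ℕ} → All P xs → ∀ {j} → j < length xs → P (xs ! j)
All-! {xs = xs} pxs j<n = All.lookup pxs (!-∈ xs j<n)

!-All : ∀ {P : ℕ → Set} (xs : List ℕ) → (∀ {j} → j < length xs → P (xs ! j)) → All P xs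
!-All []       _ = []
!-All (x ∷ xs) h = h (s≤s z≤n) ∷ !-All xs (h ∘ s≤s)

!-injective : ∀ {xs : List ℕ} → Unique xs → ∀ {j k} → j < length xs → k < length xs →
              xs ! j ≡ xs ! k → j ≡ k
!-injective {x ∷ xs} (x∉ ∷ u) {zero}  {zero}  _ _ _ = refl
!-injective {x ∷ xs} (x∉ ∷ u) {zero}  {suc k} _ (s≤s k<n) eq =
  contradiction eq (All-! x∉ k<n)
!-injective {x ∷ xs} (x∉ ∷ u) {suc j} {zero}  (s≤s j<n) _ eq =
  contradiction (sym eq) (All-! x∉ j<n)
!-injective {x ∷ xs} (x∉ ∷ u) {suc j} {suc k} (s≤s j<n) (s≤s k<n) eq =
  cong suc (!-injective u j<n k<n eq)

module _ (P : ℕ → Bool) where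

  one-hit : ∀ xs → 1 ≤ length (filterᵇ P xs) → ∃[ j ] j < length xs × T (P (xs ! j))
  one-hit (x ∷ xs) h with P x in Px
  ... | true  = zero , s≤s z≤n , from T-≡ Px
  ... | false with j , j<n , Pj ← one-hit xs h = suc j , s≤s j<n , Pj

  two-hits : ∀ xs → 2 ≤ length (filterᵇ P xs) →
             ∃₂ λ j j′ → j < j′ × j′ < length xs × T (P (xs ! j)) × T (P (xs ! j′))
  two-hits (x ∷ xs) h with P x in Px
  ... | true with j , j<n , Pj ← one-hit xs (s≤s⁻¹ h) =
    zero , suc j , s≤s z≤n , s≤s j<n , from T-≡ Px , Pj
  ... | false with j , j′ , j<j′ , j′<n , Pj , Pj′ ← two-hits xs h =
    suc j , suc j′ , s≤s j<j′ , s≤s j′<n , Pj , Pj′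

  one-hit⇒ : ∀ xs {j} → j < length xs → T (P (xs ! j)) → 1 ≤ length (filterᵇ P xs)
  one-hit⇒ (x ∷ xs) {zero} _ Px with P x
  ... | true = s≤s z≤n
  one-hit⇒ (x ∷ xs) {suc j} (s≤s j<n) Pj with P x
  ... | true  = s≤s z≤n
  ... | false = one-hit⇒ xs j<n Pj

  two-hits⇒ : ∀ xs {j j′} → j < j′ → j′ < length xs → T (P (xs ! j)) → T (P (xs ! j′)) →
              2 ≤ length (filterᵇ P xs)
  two-hits⇒ (x ∷ xs) {zero} {suc j′} _ (s≤s j′<n) Px Pj′ with P x
  ... | true = s≤s (one-hit⇒ xs j′<n Pj′)
  two-hits⇒ (x ∷ xs) {suc j} {suc j′} (s≤s j<j′) (s≤s j′<n) Pj Pj′ with P x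
  ... | true  = s≤s (one-hit⇒ xs j′<n Pj′)
  ... | false = two-hits⇒ xs j<j′ j′<n Pj Pj′

  no-hits : ∀ xs → (∀ {t} → t < length xs → ¬ T (P (xs ! t))) → length (filterᵇ P xs) ≡ 0
  no-hits xs none = cong length (filter-none (T? ∘ P) (!-All xs none))

  exactly-one-hit : ∀ xs {j} → j < length xs → T (P (xs ! j)) →
                    (∀ {t} → t < length xs → T (P (xs ! t)) → t ≡ j) → length (filterᵇ P xs) ≡ 1
  exactly-one-hit (x ∷ xs) {zero} _ Px only with P x
  ... | true = cong suc (no-hits xs λ t<n Pt → 0≢1+n (sym (only (s≤s t<n) Pt)))
  exactly-one-hit (x ∷ xs) {suc j} (s≤s j<n) Pj only with P x in Px
  ... | true  = contradiction (only (s≤s z≤n) (from T-≡ Px)) 0≢1+n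
  ... | false = exactly-one-hit xs j<n Pj λ t<n Pt → suc-injective (only (s≤s t<n) Pt)

  exactly-two-hits : ∀ xs {j j′} → j < j′ → j′ < length xs → T (P (xs ! j)) → T (P (xs ! j′)) →
                     (∀ {t} → t < length xs → T (P (xs ! t)) → t ≡ j ⊎ t ≡ j′) →
                     length (filterᵇ P xs) ≡ 2
  exactly-two-hits (x ∷ xs) {zero} {suc j′} _ (s≤s j′<n) Px Pj′ only with P x
  ... | true = cong suc (exactly-one-hit xs j′<n Pj′ λ t<n Pt →
                 [ (λ ()) , suc-injective ]′ (only (s≤s t<n) Pt))
  exactly-two-hits (x ∷ xs) {suc j} {suc j′} (s≤s j<j′) (s≤s j′<n) Pj Pj′ only with P x in Px
  ... | true  = ⊥-elim ([ 0≢1+n , 0≢1+n ]′ (only (s≤s z≤n) (from T-≡ Px)))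
  ... | false = exactly-two-hits xs j<j′ j′<n Pj Pj′ λ t<n Pt →
                  Sum.map suc-injective suc-injective (only (s≤s t<n) Pt)

-- Occurrences of a consecutive pattern

T-all : ∀ {A : Set} (P : A → Bool) xs → T (all P xs) ⇔ All (T ∘ P) xs
T-all P []       = mk⇔ (λ _ → []) (λ _ → tt)
T-all P (x ∷ xs) = mk⇔
  (λ h → let Px , Pxs = to T-∧ h in Px ∷ to (T-all P xs) Pxs)
  (λ { (Px ∷ Pxs) → from T-∧ (Px , from (T-all P xs) Pxs) })

T-all-range : ∀ (P : ℕ → Bool) n → T (all P (map suc (upTo n))) ⇔ (∀ {j} → j < n → T (P (suc j)))
T-all-range P n = mk⇔ sound complete
  where
  sound : T (all P (map suc (upTo n))) → ∀ {j} → j < n → T (P (suc j))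
  sound h = All.applyUpTo⁻ (λ j → j) n (All.map⁻ (to (T-all P _) h))
  complete : (∀ {j} → j < n → T (P (suc j))) → T (all P (map suc (upTo n)))
  complete h = from (T-all P _) (All.map⁺ (All.applyUpTo⁺₁ (λ j → j) n h))

T-==-<ᵇ : ∀ a b c d → T ((a <ᵇ b) == (c <ᵇ d)) ⇔ (a < b ⇔ c < d)
T-==-<ᵇ a b c d with a <ᵇ b | <ᵇ-reflects-< a b | c <ᵇ d | <ᵇ-reflects-< c d
... | true  | ofʸ a<b | true  | ofʸ c<d = mk⇔ (λ _ → mk⇔ (λ _ → c<d) (λ _ → a<b)) (λ _ → tt)
... | true  | ofʸ a<b | false | ofⁿ c≮d = mk⇔ (λ ()) (λ a<b⇔c<d → c≮d (to a<b⇔c<d a<b))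
... | false | ofⁿ a≮b | true  | ofʸ c<d = mk⇔ (λ ()) (λ a<b⇔c<d → a≮b (from a<b⇔c<d c<d))
... | false | ofⁿ a≮b | false | ofⁿ c≮d =
  mk⇔ (λ _ → mk⇔ (λ a<b → contradiction a<b a≮b) (λ c<d → contradiction c<d c≮d)) (λ _ → tt)

SameOrder : ℕ → (ℕ → ℕ) → (ℕ → ℕ) → Set
SameOrder n f g = ∀ {j k} → j < n → k < n → f j < f k ⇔ g j < g k

SameOrder-trans : ∀ {n f g h} → SameOrder n f g → SameOrder n g h → SameOrder n f h
SameOrder-trans f~g g~h j<n k<n = g~h j<n k<n ⇔-∘ f~g j<n k<n

SameOrder-≗ : ∀ {n f g} → (∀ {j} → j < n → f j ≡ g j) → SameOrder n f g
SameOrder-≗ {f = f} {g} f≗g j<n k<n rewrite f≗g j<n | f≗g k<n = mk⇔ (λ x → x) (λ x → x)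

Occurrence : List ℕ → List ℕ → Set
Occurrence p u = length u ≡ length p × SameOrder (length p) (u !_) (p !_)

isOcc⇔Occurrence : ∀ p u → T (isOcc p u) ⇔ Occurrence p u
isOcc⇔Occurrence p u = mk⇔ sound complete
  where
  ℓ = length p
  sound : T (isOcc p u) → Occurrence p u
  sound h with len , ord ← to T-∧ h = ≡ᵇ⇒≡ _ _ len , λ {j} {k} j<ℓ k<ℓ →
    to (T-==-<ᵇ _ _ _ _) (to (T-all-range _ ℓ) (to (T-all-range _ ℓ) ord j<ℓ) k<ℓ)
  complete : Occurrence p u → T (isOcc p u)
  complete (len , ord) = from T-∧ (≡⇒≡ᵇ _ _ len , from (T-all-range _ ℓ) λ j<ℓ →
    from (T-all-range _ ℓ) λ k<ℓ → from (T-==-<ᵇ _ _ _ _) (ord j<ℓ k<ℓ))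

occurrence-window⇔ : ∀ p v a → Occurrence p (take (length p) (drop a v)) ⇔
  (length p ≤ length v ∸ a × SameOrder (length p) (λ j → v ! (a + j)) (p !_))
occurrence-window⇔ p v a = mk⇔
  (λ (len , ord) → fits⇐ len , SameOrder-trans (SameOrder-≗ (sym ∘ window)) ord)
  (λ (fits , ord) → fits⇒ fits , SameOrder-trans (SameOrder-≗ window) ord)
  where
  ℓ = length p
  window : ∀ {j} → j < ℓ → take ℓ (drop a v) ! j ≡ v ! (a + j)
  window {j} j<ℓ = trans (!-take (drop a v) j<ℓ) (!-drop v a j)
  length-window : length (take ℓ (drop a v)) ≡ ℓ ⊓ (length v ∸ a)
  length-window = trans (length-take ℓ (drop a v)) (cong (ℓ ⊓_) (length-drop a v))
  fits⇐ : length (take ℓ (drop a v)) ≡ ℓ → ℓ ≤ length v ∸ a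
  fits⇐ len = m⊓n≡m⇒m≤n (trans (sym length-window) len)
  fits⇒ : ℓ ≤ length v ∸ a → length (take ℓ (drop a v)) ≡ ℓ
  fits⇒ fits = trans length-window (m≤n⇒m⊓n≡m fits)

-- Strictly increasing relabellings

StrictlyIncreasing : (ℕ → ℕ) → Set
StrictlyIncreasing φ = ∀ {x y} → x < y → φ x < φ y

strictlyIncreasing-reflects : ∀ {φ} → StrictlyIncreasing φ → ∀ {x y} → φ x < φ y → x < y
strictlyIncreasing-reflects {φ} φ↑ {x} {y} φx<φy with <-cmp x y
... | tri< x<y _ _ = x<y
... | tri≈ _ refl _ = contradiction φx<φy (<-irrefl refl)
... | tri> _ _ y<x = contradiction (φ↑ y<x) (<-asym φx<φy)

SameOrder-∘ : ∀ {n φ f} → StrictlyIncreasing φ → SameOrder n (λ j → φ (f j)) f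
SameOrder-∘ φ↑ _ _ = mk⇔ (strictlyIncreasing-reflects φ↑) φ↑

SameSide : ℕ → ℕ → ℕ → ℕ → Set
SameSide x x′ y y′ = (x < y × x′ < y′) ⊎ (y < x × y′ < x′)

-- Lifts the band [L, U] so that c lands on U; the offsets 0, U ∸ c and U grow with v, which
-- keeps bandShift L U c strictly increasing.
offset : (L U c v : ℕ) → ℕ
offset L U c v with v <? L | U <? v
... | yes _ | _     = 0
... | no _  | yes _ = U
... | no _  | no _  = U ∸ c

offset-monotone : ∀ L U c {v v′} → v ≤ v′ → offset L U c v ≤ offset L U c v′
offset-monotone L U c {v} {v′} v≤v′ with v <? L | U <? v | v′ <? L | U <? v′
... | yes _  | _       | _        | _       = z≤n
... | no v≮L | _       | yes v′<L | _       = contradiction (≤-<-trans v≤v′ v′<L) v≮L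
... | no _   | yes _   | no _     | yes _   = ≤-refl
... | no _   | yes U<v | no _     | no U≮v′ = contradiction (<-≤-trans U<v v≤v′) U≮v′
... | no _   | no _    | no _     | yes _   = m∸n≤m U c
... | no _   | no _    | no _     | no _    = ≤-refl

bandShift : (L U c v : ℕ) → ℕ
bandShift L U c v = v + offset L U c v

bandShift-increasing : ∀ L U c → StrictlyIncreasing (bandShift L U c)
bandShift-increasing L U c v<v′ = +-mono-<-≤ v<v′ (offset-monotone L U c (<⇒≤ v<v′))

bandShift-outside : ∀ {L U v} c c′ → v < L ⊎ U < v → bandShift L U c v ≡ bandShift L U c′ v
bandShift-outside {L} {U} {v} c c′ outside with v <? L | U <? v | outside
... | yes _  | _      | _        = refl
... | no _   | yes _  | _        = refl
... | no v≮L | no _   | inj₁ v<L = contradiction v<L v≮L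
... | no _   | no U≮v | inj₂ U<v = contradiction U<v U≮v

bandShift-centre : ∀ {L U c} → L ≤ c → c ≤ U → bandShift L U c c ≡ U
bandShift-centre {L} {U} {c} L≤c c≤U with c <? L | U <? c
... | yes c<L | _       = contradiction L≤c (<⇒≱ c<L)
... | no _    | yes U<c = contradiction c≤U (<⇒≱ U<c)
... | no _    | no _    = m+[n∸m]≡n c≤U

bandShift-≥ : ∀ L U c v → v ≤ bandShift L U c v
bandShift-≥ L U c v = m≤m+n v (offset L U c v)

splice : (ℕ → ℕ) → (ℕ → ℕ) → ℕ → List ℕ → List ℕ
splice φ ψ s w = map φ (take s w) ++ map ψ (drop s w)

length-splice : ∀ φ ψ s w → length (splice φ ψ s w) ≡ length w
length-splice φ ψ zero    w       = length-map ψ w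
length-splice φ ψ (suc s) []      = refl
length-splice φ ψ (suc s) (x ∷ w) = cong suc (length-splice φ ψ s w)

!-splice-< : ∀ φ ψ {s} w {j} → j < s → j < length w → splice φ ψ s w ! j ≡ φ (w ! j)
!-splice-< φ ψ {suc s} (x ∷ w) {zero}  _         _         = refl
!-splice-< φ ψ {suc s} (x ∷ w) {suc j} (s≤s j<s) (s≤s j<w) = !-splice-< φ ψ w j<s j<w

!-splice-≥ : ∀ φ ψ s w {j} → s + j < length w → splice φ ψ s w ! (s + j) ≡ ψ (w ! (s + j))
!-splice-≥ φ ψ zero    w       s+j<w       = !-map ψ w s+j<w
!-splice-≥ φ ψ (suc s) (x ∷ w) (s≤s s+j<w) = !-splice-≥ φ ψ s w s+j<w

splice-positive : ∀ {φ ψ} s {w} → (∀ x → x ≤ φ x) → (∀ x → x ≤ ψ x) → All (0 <_) w →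
                  All (0 <_) (splice φ ψ s w)
splice-positive s φ≥ ψ≥ pos = All.++⁺
  (All.map⁺ (All.map (λ {x} 0<x → <-≤-trans 0<x (φ≥ x)) (All.take⁺ s pos)))
  (All.map⁺ (All.map (λ {x} 0<x → <-≤-trans 0<x (ψ≥ x)) (All.drop⁺ s pos)))

0<+m-+n⇒n<m : ∀ {m n} → 0ℤ ℤ.< ℤ.+ m ℤ.- ℤ.+ n → n < m
0<+m-+n⇒n<m {m} {n} 0<m-n with n <? m
... | yes n<m = n<m
... | no n≮m = contradiction (ℤ.<-≤-trans 0<m-n (ℤ.i≤j⇒i-j≤0 (ℤ.+≤+ (≮⇒≥ n≮m)))) (ℤ.<-irrefl refl)

n<m⇒0<+m-+n : ∀ {m n} → n < m → 0ℤ ℤ.< ℤ.+ m ℤ.- ℤ.+ n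
n<m⇒0<+m-+n {m} {n} n<m =
  subst (0ℤ ℤ.<_) (sym (trans (ℤ.[+m]-[+n]≡m⊖n m n) (ℤ.⊖-≥ (<⇒≤ n<m)))) (+<+ (m<n⇒0<n∸m n<m))

+m-+n-1≡+m-+[n+1] : ∀ m n → ℤ.+ m ℤ.- ℤ.+ n ℤ.- ℤ.+ 1 ≡ ℤ.+ m ℤ.- ℤ.+ (n + 1)
+m-+n-1≡+m-+[n+1] m n =
  trans (ℤ.+-assoc (ℤ.+ m) (ℤ.- ℤ.+ n) (ℤ.- ℤ.+ 1))
        (cong (ℤ._+_ (ℤ.+ m)) (sym (ℤ.neg-distrib-+ (ℤ.+ n) (ℤ.+ 1))))

0<⊓ : ∀ {x y} → 0ℤ ℤ.< x → 0ℤ ℤ.< y → 0ℤ ℤ.< x ℤ.⊓ y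
0<⊓ {x} {y} 0<x 0<y with ℤ.⊓-sel x y
... | inj₁ x⊓y≡x = subst (0ℤ ℤ.<_) (sym x⊓y≡x) 0<x
... | inj₂ x⊓y≡y = subst (0ℤ ℤ.<_) (sym x⊓y≡y) 0<y

0<⊓⇒ : ∀ {x y} → 0ℤ ℤ.< x ℤ.⊓ y → 0ℤ ℤ.< x × 0ℤ ℤ.< y
0<⊓⇒ {x} {y} 0<x⊓y = ℤ.<-≤-trans 0<x⊓y (ℤ.i⊓j≤i x y) , ℤ.<-≤-trans 0<x⊓y (ℤ.i⊓j≤j x y)

-- Permutations of a multiset

Letter : ℕ → ℕ → Set
Letter n x = 1 ≤ x × x ≤ n

letter : ∀ {n} → Fin n → ℕ
letter j = suc (toℕ j)

IsPermutationOf : ∀ {n} → (Fin n → ℕ) → List ℕ → Set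
IsPermutationOf {n} k v = All (Letter n) v × (∀ j → count (letter j) v ≡ k j)

words-complete : ∀ n {L} v → length v ≡ L → All (Letter n) v → v ∈ words n L
words-complete n []          refl []                 = here refl
words-complete n (suc x ∷ v) refl ((_ , x<n) ∷ letters) =
  ∈-concatMap⁺ _ (lose x∈alphabet (∈-map⁺ (suc x ∷_) (words-complete n v refl letters)))
  where
  x∈alphabet : suc x ∈ map letter (allFin n)
  x∈alphabet = subst (_∈ map letter (allFin n)) (cong suc (toℕ-fromℕ< x<n))
                 (∈-map⁺ letter (∈-allFin (fromℕ< x<n)))

words-sound : ∀ n L {v} → v ∈ words n L → length v ≡ L × All (Letter n) v
words-sound n zero    (here refl) = refl , []
words-sound n (suc L) v∈
  with x , x∈alphabet , v∈x∷words ← find (∈-concatMap⁻ _ {xs = map letter (allFin n)} v∈)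
  with j , _ , refl ← ∈-map⁻ letter x∈alphabet
  with u , u∈ , refl ← ∈-map⁻ (letter j ∷_) v∈x∷words
  with len , letters ← words-sound n L u∈ = cong suc len , (s≤s z≤n , toℕ<n j) ∷ letters

T-isPermOfM : ∀ {n} (k : Fin n → ℕ) v → T (isPermOfM k v) ⇔ (∀ j → count (letter j) v ≡ k j)
T-isPermOfM k v = mk⇔
  (λ h j → ≡ᵇ⇒≡ _ _ (All.tabulate⁻ (to (T-all _ _) h) j))
  (λ h → from (T-all _ _) (All.tabulate⁺ λ j → ≡⇒≡ᵇ _ _ (h j)))

sum-tabulate : ∀ n (f : Fin n → ℕ) → sum (tabulate f) ≡ FinSum.sum f
sum-tabulate zero    f = refl
sum-tabulate (suc n) f = cong (f zero +_) (sum-tabulate n (f ∘ suc))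

sum-allFin : ∀ n (f : Fin n → ℕ) → sum (map f (allFin n)) ≡ FinSum.sum f
sum-allFin n f = trans (cong sum (map-tabulate (λ j → j) f)) (sum-tabulate n f)

sum-allFin-permute : ∀ {n} (k : Fin n → ℕ) (τ : Permutation′ n) →
                     sum (map (λ j → k (τ ⟨$⟩ˡ j)) (allFin n)) ≡ sum (map k (allFin n))
sum-allFin-permute {n} k τ =
  trans (sum-allFin n _) (trans (sym (FinSum.sum-permute k (flip τ))) (sym (sum-allFin n k)))

count-∷ : ∀ c y v → count c (y ∷ v) ≡ (if y ≡ᵇ c then 1 else 0) + count c v
count-∷ c y v with y ≡ᵇ c
... | true  = refl
... | false = refl

sum-indicator : ∀ {n y} → Letter n y →
                FinSum.sum (λ (j : Fin n) → if y ≡ᵇ letter j then 1 else 0) ≡ 1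
sum-indicator {suc n} {suc zero}    _               = cong suc (FinSum.sum-replicate-zero n)
sum-indicator {suc n} {suc (suc y)} (_ , s≤s y<n) = sum-indicator (s≤s z≤n , y<n)

sum-counts : ∀ {n} v → All (Letter n) v → FinSum.sum (λ (j : Fin n) → count (letter j) v) ≡ length v
sum-counts {n} []      []                    = FinSum.sum-replicate-zero n
sum-counts {n} (y ∷ v) (y-letter ∷ letters) = begin
  FinSum.sum {n} (λ j → count (letter j) (y ∷ v)) ≡⟨ FinSum.sum-cong-≗ {n} (λ j → count-∷ (letter j) y v) ⟩
  FinSum.sum {n} (λ j → indicator j + counts j)   ≡⟨ FinSum.∑-distrib-+ indicator counts ⟩
  FinSum.sum indicator + FinSum.sum counts        ≡⟨ cong₂ _+_ (sum-indicator y-letter) (sum-counts v letters) ⟩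
  suc (length v)                                  ∎
  where
  open ≡-Reasoning
  indicator counts : Fin n → ℕ
  indicator j = if y ≡ᵇ letter j then 1 else 0
  counts j = count (letter j) v

length-permutation : ∀ {n} {k : Fin n → ℕ} {v} → IsPermutationOf k v →
                     length v ≡ sum (map k (allFin n))
length-permutation {n} {k} {v} (letters , counts) =
  trans (sym (sum-counts v letters)) (trans (FinSum.sum-cong-≗ counts) (sym (sum-allFin n k)))

cardMstar-pos : ∀ {n} (k : Fin n → ℕ) p s {w} → IsPermutationOf k w → occurrences p w ≡ s →
                1 ≤ cardMstar k p s
cardMstar-pos {n} k p s {w} perm@(letters , counts) occ =
  ∈-length (∈-filter⁺ (T? ∘ _) (words-complete n w (length-permutation perm) letters)
    (from T-∧ (from (T-isPermOfM k w) counts , ≡⇒≡ᵇ _ _ occ)))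

cardMstar-zero : ∀ {n} (k : Fin n → ℕ) p s → (∀ v → IsPermutationOf k v → occurrences p v ≢ s) →
                 cardMstar k p s ≡ 0
cardMstar-zero {n} k p s none = cong length (filter-none (T? ∘ _) (All.tabulate excluded))
  where
  L = sum (map k (allFin n))
  excluded : ∀ {v} → v ∈ words n L → ¬ T (isPermOfM k v ∧ (occurrences p v ≡ᵇ s))
  excluded {v} v∈ h with perm , occ ← to T-∧ h =
    none v (proj₂ (words-sound n L v∈) , to (T-isPermOfM k v) perm) (≡ᵇ⇒≡ _ _ occ)

transpose-⟨$⟩ˡ : ∀ {n} (i j : Fin n) → transpose i j ⟨$⟩ˡ i ≡ j
transpose-⟨$⟩ˡ i j with i Fin.≟ j
... | yes i≡j = i≡j
... | no _ with i Fin.≟ i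
...   | yes _   = refl
...   | no i≢i = contradiction refl i≢i

cardMstar-transpose≡0 : ∀ {n} (k : Fin n → ℕ) p s (e c : Fin n) → 2 ≤ k c →
  (∀ v → length v ≡ sum (map k (allFin n)) → All (Letter n) v → 2 ≤ count (letter e) v →
         occurrences p v ≢ s) →
  cardMstar (λ j → k (transpose e c ⟨$⟩ˡ j)) p s ≡ 0
cardMstar-transpose≡0 k p s e c 2≤kc forbidden = cardMstar-zero _ p s λ v perm@(letters , counts) →
  forbidden v (trans (length-permutation perm) (sum-allFin-permute k (transpose e c))) letters
    (subst (2 ≤_) (sym (trans (counts e) (cong k (transpose-⟨$⟩ˡ e c)))) 2≤kc)

letter⁻¹ : ∀ {n c} → Letter n c → Fin n
letter⁻¹ {c = suc c} (_ , c<n) = fromℕ< c<n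

letter-letter⁻¹ : ∀ {n c} (c-letter : Letter n c) → letter (letter⁻¹ c-letter) ≡ c
letter-letter⁻¹ {c = suc c} (_ , c<n) = cong suc (toℕ-fromℕ< c<n)

multiplicities : (w : List ℕ) → Fin (max 0 w) → ℕ
multiplicities w j = count (letter j) w

multiplicities-permutation : ∀ {w} → All (0 <_) w → IsPermutationOf (multiplicities w) w
multiplicities-permutation {w} pos = All.zip (pos , xs≤max 0 w) , λ _ → refl

repeated-multiplicity : ∀ {w u u′} → All (0 <_) w → u < u′ → u′ < length w → w ! u ≡ w ! u′ →
                        ∃[ c ] 2 ≤ multiplicities w c
repeated-multiplicity {w} {u} pos u<u′ u′<len tie =
  letter⁻¹ wu-letter ,
  subst (λ x → 2 ≤ count x w) (sym (letter-letter⁻¹ wu-letter))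
    (two-hits⇒ (_≡ᵇ w ! u) w u<u′ u′<len (≡⇒≡ᵇ (w ! u) _ refl) (≡⇒≡ᵇ _ (w ! u) (sym tie)))
  where
  wu-letter : Letter (max 0 w) (w ! u)
  wu-letter = All-! (proj₁ (multiplicities-permutation pos)) (<-trans u<u′ u′<len)

-- Patterns and their overlapping occurrences

module Pattern (p : List ℕ) (p↭ : p ↭ map suc (upTo (length p))) where

  ℓ : ℕ
  ℓ = length p

  pattern-range : ∀ {j} → j < ℓ → 1 ≤ p ! j × p ! j ≤ ℓ
  pattern-range j<ℓ with y , y∈ , eq ← ∈-map⁻ suc (∈-resp-↭ p↭ (!-∈ p j<ℓ)) rewrite eq =
    s≤s z≤n , ∈-upTo⁻ y∈

  pattern-surjective : ∀ {x} → 1 ≤ x → x ≤ ℓ → ∃[ t ] t < ℓ × p ! t ≡ x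
  pattern-surjective {suc x} _ x<ℓ = ∈⇒! (∈-resp-↭ (↭-sym p↭) (∈-map⁺ suc (∈-upTo⁺ x<ℓ)))

  pattern-unique : Unique p
  pattern-unique = ↭ₛ.Unique-resp-↭ (setoid ℕ) (↭⇒↭ₛ (↭-sym p↭))
                     (Unique.map⁺ suc-injective (Unique.upTo⁺ ℓ))

  pattern-injective : ∀ {j k} → j < ℓ → k < ℓ → p ! j ≡ p ! k → j ≡ k
  pattern-injective = !-injective pattern-unique

  ordered-injective : ∀ {f} → SameOrder ℓ f (p !_) → ∀ {j k} → j < ℓ → k < ℓ → f j ≡ f k → j ≡ k
  ordered-injective f~p {j} {k} j<ℓ k<ℓ fj≡fk with <-cmp (p ! j) (p ! k)
  ... | tri< pj<pk _ _ = contradiction fj≡fk (<⇒≢ (from (f~p j<ℓ k<ℓ) pj<pk))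
  ... | tri≈ _ pj≡pk _ = pattern-injective j<ℓ k<ℓ pj≡pk
  ... | tri> _ _ pk<pj = contradiction (sym fj≡fk) (<⇒≢ (from (f~p k<ℓ j<ℓ) pk<pj))

  ordered-minimum : ∀ {f u} → SameOrder ℓ f (p !_) → u < ℓ → (∀ {k} → k < ℓ → f u ≤ f k) → p ! u ≡ 1
  ordered-minimum f~p u<ℓ fu-min with t , t<ℓ , pt≡1 ← pattern-surjective ≤-refl (≤-trans (s≤s z≤n) u<ℓ) =
    ≤-antisym (≮⇒≥ λ 1<pu → <⇒≱ (from (f~p t<ℓ u<ℓ) (subst (_< p ! _) (sym pt≡1) 1<pu)) (fu-min t<ℓ))
              (proj₁ (pattern-range u<ℓ))

  ordered-maximum : ∀ {f u} → SameOrder ℓ f (p !_) → u < ℓ → (∀ {k} → k < ℓ → f k ≤ f u) → p ! u ≡ ℓ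
  ordered-maximum f~p u<ℓ fu-max with t , t<ℓ , pt≡ℓ ← pattern-surjective (≤-trans (s≤s z≤n) u<ℓ) ≤-refl =
    ≤-antisym (proj₂ (pattern-range u<ℓ))
              (≮⇒≥ λ pu<ℓ → <⇒≱ (from (f~p u<ℓ t<ℓ) (subst (p ! _ <_) (sym pt≡ℓ) pu<ℓ)) (fu-max t<ℓ))

  module Overlap (i : ℕ) (min-ext : MinExtendable p i) where

    -- The shift between two overlapping occurrences and the length of their overlap.
    s m : ℕ
    s = i ∸ 1
    m = ℓ ∸ i + 1

    private
      2≤i : 2 ≤ i
      2≤i = proj₁ (proj₁ min-ext)
      i≤ℓ : i ≤ ℓ
      i≤ℓ = proj₁ (proj₂ (proj₁ min-ext))

    1≤s : 1 ≤ s
    1≤s = ∸-monoˡ-≤ 1 2≤i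

    1≤m : 1 ≤ m
    1≤m = m≤n+m 1 (ℓ ∸ i)

    m+s≡ℓ : m + s ≡ ℓ
    m+s≡ℓ = begin
      ℓ ∸ i + 1 + (i ∸ 1)   ≡⟨ +-assoc (ℓ ∸ i) 1 (i ∸ 1) ⟩
      ℓ ∸ i + (1 + (i ∸ 1)) ≡⟨ cong (ℓ ∸ i +_) (m+[n∸m]≡n (≤-trans (s≤s z≤n) 2≤i)) ⟩
      ℓ ∸ i + i             ≡⟨ m∸n+n≡m i≤ℓ ⟩
      ℓ                     ∎
      where open ≡-Reasoning

    s<ℓ : s < ℓ
    s<ℓ = subst (s <_) m+s≡ℓ (+-monoˡ-≤ s 1≤m)

    m<ℓ : m < ℓ
    m<ℓ = subst (m <_) (trans (+-comm s m) m+s≡ℓ) (+-monoˡ-≤ m 1≤s)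

    shared-<ℓ : ∀ {t} → t < m → t + s < ℓ
    shared-<ℓ {t} t<m = subst (t + s <_) m+s≡ℓ (+-monoˡ-< s t<m)

    shift-< : ∀ {k} → k < ℓ → s + k < ℓ + s
    shift-< {k} k<ℓ = subst (s + k <_) (+-comm s ℓ) (+-monoʳ-< s k<ℓ)

    unshared-index : ∀ {u} → ℓ ≤ u → u < ℓ + s → m ≤ u ∸ s × u ∸ s < ℓ × s + (u ∸ s) ≡ u
    unshared-index {u} ℓ≤u u<ℓ+s =
      subst (_≤ u ∸ s) (m+n∸n≡m m s) (∸-monoˡ-≤ s (subst (_≤ u) (sym m+s≡ℓ) ℓ≤u)) ,
      subst (u ∸ s <_) (m+n∸n≡m ℓ s) (∸-monoˡ-< u<ℓ+s s≤u) ,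
      m+[n∸m]≡n s≤u
      where s≤u = ≤-trans (<⇒≤ s<ℓ) ℓ≤u

    OccursAt : List ℕ → ℕ → Set
    OccursAt v a = T (isOcc p (take ℓ (drop a v)))

    occurs⇔ : ∀ v a → OccursAt v a ⇔ (ℓ ≤ length v ∸ a × SameOrder ℓ (λ j → v ! (a + j)) (p !_))
    occurs⇔ v a = occurrence-window⇔ p v a ⇔-∘ isOcc⇔Occurrence p (take ℓ (drop a v))

    Windows : List ℕ → Set
    Windows v = SameOrder ℓ (v !_) (p !_) × SameOrder ℓ (λ j → v ! (s + j)) (p !_)

    occurs⇒windows : ∀ {v} → OccursAt v 0 → OccursAt v s → Windows v
    occurs⇒windows {v} occ₀ occₛ = proj₂ (to (occurs⇔ v 0) occ₀) , proj₂ (to (occurs⇔ v s) occₛ)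

    windows⇒occurs : ∀ {v} → length v ≡ ℓ + s → Windows v → OccursAt v 0 × OccursAt v s
    windows⇒occurs {v} len (win₀ , winₛ) =
      from (occurs⇔ v 0) (subst (ℓ ≤_) (sym len) (m≤m+n ℓ s) , win₀) ,
      from (occurs⇔ v s) (≤-reflexive (sym (trans (cong (_∸ s) len) (m+n∸n≡m ℓ s))) , winₛ)

    occurrence-start≤s : ∀ {v b} → length v ≡ ℓ + s → OccursAt v b → b ≤ s
    occurrence-start≤s {v} {b} len occ = +-cancelˡ-≤ ℓ b s (m≤o∸n⇒m+n≤o ℓ (<⇒≤ b<ℓ+s) fits)
      where
      fits : ℓ ≤ ℓ + s ∸ b
      fits = subst (λ n → ℓ ≤ n ∸ b) len (proj₁ (to (occurs⇔ v b) occ))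
      b<ℓ+s : b < ℓ + s
      b<ℓ+s = m∸n≢0⇒n<m λ ℓ+s∸b≡0 → <⇒≱ (≤-<-trans z≤n s<ℓ) (subst (ℓ ≤_) ℓ+s∸b≡0 fits)

    -- Occurrences at a < b span the word u below, which makes b − a + 1 an extendable index.
    overlapping-occurrences : ∀ {v a b} → length v ≡ ℓ + s → All (0 <_) v → a < b →
                              OccursAt v a → OccursAt v b → a ≡ 0 × b ≡ s
    overlapping-occurrences {v} {a} {b} len pos a<b occ-a occ-b = a≡0 , b≡s
      where
      d = b ∸ a
      a+d≡b : a + d ≡ b
      a+d≡b = m+[n∸m]≡n (<⇒≤ a<b)
      b≤s = occurrence-start≤s len occ-b
      d≤b : d ≤ b
      d≤b = m∸n≤m b a
      y = drop a v
      ℓ+d≤ : ℓ + d ≤ length y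
      ℓ+d≤ = subst (ℓ + d ≤_) (sym (trans (length-drop a v) (cong (_∸ a) len)))
        (m+n≤o⇒m≤o∸n (ℓ + d) (subst (_≤ ℓ + s) (sym (trans (+-assoc ℓ d a)
          (cong (ℓ +_) (trans (+-comm d a) a+d≡b)))) (+-monoʳ-≤ ℓ b≤s)))
      u = take (ℓ + d) y
      length-u : length u ≡ ℓ + suc d ∸ 1
      length-u = trans (length-take (ℓ + d) y) (trans (m≤n⇒m⊓n≡m ℓ+d≤) (cong (_∸ 1) (sym (+-suc ℓ d))))
      take-u : take ℓ u ≡ take ℓ (drop a v)
      take-u = trans (take-take ℓ (ℓ + d) y) (cong (λ n → take n y) (m≤n⇒m⊓n≡m (m≤m+n ℓ d)))
      drop-u : drop d u ≡ take ℓ (drop b v)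
      drop-u = begin
        drop d (take (ℓ + d) y) ≡⟨ cong (λ n → drop d (take n y)) (+-comm ℓ d) ⟩
        drop d (take (d + ℓ) y) ≡⟨ take-drop ℓ d y ⟨
        take ℓ (drop d y)       ≡⟨ cong (take ℓ) (drop-drop a d v) ⟩
        take ℓ (drop (a + d) v) ≡⟨ cong (λ n → take ℓ (drop n v)) a+d≡b ⟩
        take ℓ (drop b v)       ∎
        where open ≡-Reasoning
      extendable : Extendable p (suc d)
      extendable = s≤s (m<n⇒0<n∸m a<b) , ≤-trans (s≤s (≤-trans d≤b b≤s)) s<ℓ ,
                   u , length-u , All.take⁺ (ℓ + d) (All.drop⁺ a pos) ,
                   trans (cong (isOcc p) take-u) (to T-≡ occ-a) ,
                   trans (cong (isOcc p) drop-u) (to T-≡ occ-b)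
      s≤d : s ≤ d
      s≤d = ∸-monoˡ-≤ 1 (proj₂ min-ext (suc d) extendable)
      b≡s = ≤-antisym b≤s (≤-trans s≤d d≤b)
      a≡0 = n≤0⇒n≡0 (+-cancelʳ-≤ d a 0 (subst (_≤ d) (sym a+d≡b) (≤-trans b≤s s≤d)))

    occurrence-starts : ∀ {v t} → length v ≡ ℓ + s → All (0 <_) v → OccursAt v 0 → OccursAt v t →
                        t ≡ 0 ⊎ t ≡ s
    occurrence-starts {t = zero}  _   _   _    _    = inj₁ refl
    occurrence-starts {t = suc t} len pos occ₀ occₜ =
      inj₂ (proj₂ (overlapping-occurrences len pos (s≤s z≤n) occ₀ occₜ))

    occurrences≡2⇒ : ∀ {v} → length v ≡ ℓ + s → All (0 <_) v → occurrences p v ≡ 2 →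
                     OccursAt v 0 × OccursAt v s
    occurrences≡2⇒ {v} len pos two
      with j , j′ , j<j′ , j′< , hit-j , hit-j′ ← two-hits _ (upTo (length v)) (≤-reflexive (sym two)) =
      subst (OccursAt v) (proj₁ starts) occ-j , subst (OccursAt v) (proj₂ starts) occ-j′
      where
      occ-j = subst (OccursAt v) (!-upTo (length v) (<-trans j<j′ j′<)) hit-j
      occ-j′ = subst (OccursAt v) (!-upTo (length v) j′<) hit-j′
      starts = overlapping-occurrences len pos j<j′ occ-j occ-j′

    occurs⇒occurrences≡2 : ∀ {v} → length v ≡ ℓ + s → All (0 <_) v → OccursAt v 0 → OccursAt v s →
                           occurrences p v ≡ 2
    occurs⇒occurrences≡2 {v} len pos occ₀ occₛ =
      exactly-two-hits _ (upTo (length v)) 1≤s s<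
        (subst (OccursAt v) (sym (!-upTo (length v) (≤-<-trans z≤n s<))) occ₀)
        (subst (OccursAt v) (sym (!-upTo (length v) s<)) occₛ)
        λ t< hit → occurrence-starts len pos occ₀ (subst (OccursAt v) (!-upTo (length v) t<) hit)
      where
      s< : s < length (upTo (length v))
      s< = subst (s <_) (sym (trans (length-upTo (length v)) len)) (≤-trans s<ℓ (m≤m+n ℓ s))

    tie-positions : ∀ {v u u′} → Windows v → u < u′ → u′ < ℓ + s → v ! u ≡ v ! u′ → u < s × ℓ ≤ u′
    tie-positions {v} {u} {u′} (win₀ , winₛ) u<u′ u′<ℓ+s tie = u<s , ℓ≤u′
      where
      ℓ≤u′ : ℓ ≤ u′
      ℓ≤u′ = ≮⇒≥ λ u′<ℓ → <⇒≢ u<u′ (ordered-injective win₀ (<-trans u<u′ u′<ℓ) u′<ℓ tie)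
      u<s : u < s
      u<s = ≰⇒> λ s≤u →
        let _ , j′<ℓ , s+j′≡u′ = unshared-index ℓ≤u′ u′<ℓ+s
            s+j≡u = m+[n∸m]≡n s≤u
            j<ℓ = ≤-<-trans (∸-monoˡ-≤ s (<⇒≤ u<u′)) j′<ℓ
            shifted-tie = trans (cong (v !_) s+j≡u) (trans tie (cong (v !_) (sym s+j′≡u′)))
        in <⇒≢ u<u′ (begin
          u             ≡⟨ s+j≡u ⟨
          s + (u ∸ s)   ≡⟨ cong (s +_) (ordered-injective winₛ j<ℓ j′<ℓ shifted-tie) ⟩
          s + (u′ ∸ s)  ≡⟨ s+j′≡u′ ⟩
          u′            ∎)
        where open ≡-Reasoning

    shared-order : ∀ {v} → Windows v → ∀ {t t′} → t < m → t′ < m →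
                   p ! t < p ! t′ → p ! (t + s) < p ! (t′ + s)
    shared-order {v} (win₀ , winₛ) {t} {t′} t<m t′<m pt<pt′ =
      to (win₀ (shared-<ℓ t<m) (shared-<ℓ t′<m))
        (subst₂ _<_ (cong (v !_) (+-comm s t)) (cong (v !_) (+-comm s t′))
          (from (winₛ (<-trans t<m m<ℓ) (<-trans t′<m m<ℓ)) pt<pt′))

    -- R is _≤_ for the smallest letter and its converse for the largest one.
    extremal-tie-position : (R : ℕ → ℕ → Set) {x : ℕ} →
      (∀ {f u} → SameOrder ℓ f (p !_) → u < ℓ → (∀ {k} → k < ℓ → R (f u) (f k)) → p ! u ≡ x) →
      ∀ {v u u′} → Windows v → u < u′ → u′ < ℓ + s → v ! u ≡ v ! u′ →
      (∀ {k} → k < ℓ + s → R (v ! u) (v ! k)) → ∃[ t ] m ≤ t × t < s × p ! t ≡ x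
    extremal-tie-position R extremal⇒x {v} {u} {u′} (win₀ , winₛ) u<u′ u′<ℓ+s tie extremal =
      let u<s , ℓ≤u′ = tie-positions {v} (win₀ , winₛ) u<u′ u′<ℓ+s tie
          m≤j , j<ℓ , s+j≡u′ = unshared-index ℓ≤u′ u′<ℓ+s
          u<ℓ = <-trans u<s s<ℓ
          pu≡x = extremal⇒x win₀ u<ℓ λ k<ℓ → extremal (<-≤-trans k<ℓ (m≤m+n ℓ s))
          pj≡x = extremal⇒x winₛ j<ℓ λ k<ℓ →
                   subst (λ c → R c (v ! (s + _))) (trans tie (cong (v !_) (sym s+j≡u′)))
                     (extremal (shift-< k<ℓ))
      in u , subst (m ≤_) (sym (pattern-injective u<ℓ j<ℓ (trans pu≡x (sym pj≡x)))) m≤j , u<s , pu≡x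

    repeated-extremal-letter : (R : ℕ → ℕ → Set) {x : ℕ} →
      (∀ {f u} → SameOrder ℓ f (p !_) → u < ℓ → (∀ {k} → k < ℓ → R (f u) (f k)) → p ! u ≡ x) →
      ∀ {v c} → length v ≡ ℓ + s → All (0 <_) v → occurrences p v ≡ 2 → 2 ≤ count c v →
      (∀ {k} → k < ℓ + s → R c (v ! k)) → ∃[ t ] m ≤ t × t < s × p ! t ≡ x
    repeated-extremal-letter R extremal⇒x {v} {c} len pos two repeated extremal
      with occ₀ , occₛ ← occurrences≡2⇒ len pos two
      with u , u′ , u<u′ , u′<len , vu≡c , vu′≡c ← two-hits (_≡ᵇ c) v repeated =
      extremal-tie-position R extremal⇒x {v} (occurs⇒windows occ₀ occₛ) u<u′ (subst (u′ <_) len u′<len)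
        (trans (≡ᵇ⇒≡ _ _ vu≡c) (sym (≡ᵇ⇒≡ _ _ vu′≡c)))
        λ {k} k< → subst (λ c′ → R c′ (v ! k)) (sym (≡ᵇ⇒≡ _ _ vu≡c)) (extremal k<)

    extension-word : ∃[ w ] length w ≡ ℓ + s × All (0 <_) w × Windows w
    extension-word with _ , _ , w , len , pos , occ₀ , occₛ ← proj₁ min-ext =
      w , length-w , pos , occurs⇒windows (from T-≡ occ₀) (from T-≡ (trans (cong (isOcc p) take-ℓ) occₛ))
      where
      length-w : length w ≡ ℓ + s
      length-w = trans len (+-∸-assoc ℓ (≤-trans (s≤s z≤n) 2≤i))
      take-ℓ : take ℓ (drop s w) ≡ drop s w
      take-ℓ = take-all ℓ (drop s w)
        (≤-reflexive (trans (length-drop s w) (trans (cong (_∸ s) length-w) (m+n∸n≡m ℓ s))))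

    shared-values-outside : ∀ {w a b′} → Windows w → a < s → b′ < ℓ →
      (∀ {t} → t < m → SameSide (p ! (t + s)) (p ! t) (p ! a) (p ! b′)) →
      ∀ {t} → t < m → w ! (s + t) < w ! a ⊓ w ! (s + b′) ⊎ w ! a ⊔ w ! (s + b′) < w ! (s + t)
    shared-values-outside {w} {a} {b′} (win₀ , winₛ) a<s b′<ℓ same-side {t} t<m =
      [ (λ (below-a , below-b) → inj₁ (⊓-glb
          (subst (_< w ! a) w-shared (from (win₀ t+s<ℓ a<ℓ) below-a)) (from (winₛ t<ℓ b′<ℓ) below-b))) ,
        (λ (above-a , above-b) → inj₂ (⊔-lub
          (subst (w ! a <_) w-shared (from (win₀ a<ℓ t+s<ℓ) above-a)) (from (winₛ b′<ℓ t<ℓ) above-b))) ]′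
      (same-side t<m)
      where
      t+s<ℓ = shared-<ℓ t<m
      a<ℓ = <-trans a<s s<ℓ
      t<ℓ = <-trans t<m m<ℓ
      w-shared = cong (w !_) (+-comm t s)

    -- The shared values of w avoid the band [L, U] spanned by w ! a and w ! (s + b′), so lifting the
    -- band relative to w ! a before position s and relative to w ! (s + b′) after it keeps both
    -- windows in order while sending both letters to U.
    tie-word : ∀ {a b′} → a < s → b′ < ℓ →
               (∀ {t} → t < m → SameSide (p ! (t + s)) (p ! t) (p ! a) (p ! b′)) →
               ∃[ W ] length W ≡ ℓ + s × All (0 <_) W × Windows W × W ! a ≡ W ! (s + b′)
    tie-word {a} {b′} a<s b′<ℓ same-side = build extension-word
      where
      build : ∃[ w ] length w ≡ ℓ + s × All (0 <_) w × Windows w →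
              ∃[ W ] length W ≡ ℓ + s × All (0 <_) W × Windows W × W ! a ≡ W ! (s + b′)
      build (w , len , pos , win₀ , winₛ) =
        W , trans (length-splice φₐ φ_b s w) len ,
        splice-positive s (bandShift-≥ L U cₐ) (bandShift-≥ L U c_b) pos ,
        (SameOrder-trans (SameOrder-≗ W-first)
           (SameOrder-trans (SameOrder-∘ (bandShift-increasing L U cₐ)) win₀) ,
         SameOrder-trans (SameOrder-≗ W-second)
           (SameOrder-trans (SameOrder-∘ (bandShift-increasing L U c_b)) winₛ)) ,
        trans W-a (sym W-b)
        where
        cₐ = w ! a
        c_b = w ! (s + b′)
        L = cₐ ⊓ c_b
        U = cₐ ⊔ c_b
        φₐ = bandShift L U cₐ
        φ_b = bandShift L U c_b
        W = splice φₐ φ_b s w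

        W-second : ∀ {j} → j < ℓ → W ! (s + j) ≡ φ_b (w ! (s + j))
        W-second j<ℓ = !-splice-≥ φₐ φ_b s w (subst (_ <_) (sym len) (shift-< j<ℓ))

        W-first : ∀ {j} → j < ℓ → W ! j ≡ φₐ (w ! j)
        W-first {j} j<ℓ with j <? s
        ... | yes j<s = !-splice-< φₐ φ_b w j<s (subst (j <_) (sym len) (<-≤-trans j<ℓ (m≤m+n ℓ s)))
        ... | no j≮s = begin
          W ! j              ≡⟨ cong (W !_) s+t≡j ⟨
          W ! (s + t)        ≡⟨ W-second (<-trans t<m m<ℓ) ⟩
          φ_b (w ! (s + t))  ≡⟨ bandShift-outside c_b cₐ
                                  (shared-values-outside {w} (win₀ , winₛ) a<s b′<ℓ same-side t<m) ⟩
          φₐ (w ! (s + t))   ≡⟨ cong (λ n → φₐ (w ! n)) s+t≡j ⟩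
          φₐ (w ! j)         ∎
          where
          open ≡-Reasoning
          t = j ∸ s
          s+t≡j = m+[n∸m]≡n (≮⇒≥ j≮s)
          t<m : t < m
          t<m = subst (t <_) (trans (cong (_∸ s) (sym m+s≡ℓ)) (m+n∸n≡m m s)) (∸-monoˡ-< j<ℓ (≮⇒≥ j≮s))

        W-a : W ! a ≡ U
        W-a = trans (W-first (<-trans a<s s<ℓ)) (bandShift-centre (m⊓n≤m cₐ c_b) (m≤m⊔n cₐ c_b))
        W-b : W ! (s + b′) ≡ U
        W-b = trans (W-second b′<ℓ) (bandShift-centre (m⊓n≤n cₐ c_b) (m≤n⊔m cₐ c_b))

    TieWord : List ℕ → Set
    TieWord W = length W ≡ ℓ + s × All (0 <_) W × occurrences p W ≡ 2 ×
                ∃₂ λ u u′ → u < u′ × u′ < length W × W ! u ≡ W ! u′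

    module Ranks (σ : Permutation′ m) (sorts : Sorts p i σ) where

      -- σ on 0-indexed ranks and positions: ρ q = σ(q + 1) − 1.
      ρ : ℕ → ℕ
      ρ q = pred (σℕ σ (suc q))

      σℕ-suc : ∀ {q} → q < m → σℕ σ (suc q) ≡ suc (ρ q)
      σℕ-suc {q} q<m with q <? m
      ... | yes _    = refl
      ... | no q≮m = contradiction q<m q≮m

      ρ<m : ∀ {q} → q < m → ρ q < m
      ρ<m {q} q<m with q <? m
      ... | yes q<m′ = toℕ<n (σ ⟨$⟩ʳ fromℕ< q<m′)
      ... | no q≮m  = contradiction q<m q≮m

      ρ-surjective : ∀ {t} → t < m → ∃[ q ] q < m × ρ q ≡ t
      ρ-surjective {t} t<m = toℕ r , toℕ<n r , ρr≡t
        where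
        r = σ ⟨$⟩ˡ fromℕ< t<m
        ρr≡t : ρ (toℕ r) ≡ t
        ρr≡t with toℕ r <? m
        ... | yes r<m = trans (cong (λ r′ → toℕ (σ ⟨$⟩ʳ r′)) (fromℕ<-toℕ r r<m))
                              (trans (cong toℕ (inverseʳ σ)) (toℕ-fromℕ< t<m))
        ... | no r≮m = contradiction (toℕ<n r) r≮m

      -- shared 0 q = p_{σ(q+1)} and shared s q = p_{σ(q+1)+i−1}: the (q + 1)-th smallest shared
      -- value as seen by the second and by the first occurrence, the terms of δ^1 and δ^2.
      shared : ℕ → ℕ → ℕ
      shared sft q = p ! (ρ q + sft)

      Increasing : (ℕ → ℕ) → Set
      Increasing f = ∀ {q q′} → q < q′ → q′ < m → f q < f q′

      increasing-≤ : ∀ {f} → Increasing f → ∀ {q q′} → q ≤ q′ → q′ < m → f q ≤ f q′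
      increasing-≤ f↑ q≤q′ q′<m with m≤n⇒m<n∨m≡n q≤q′
      ... | inj₁ q<q′ = <⇒≤ (f↑ q<q′ q′<m)
      ... | inj₂ refl = ≤-refl

      shared-position<ℓ : ∀ {sft q} → sft ≤ s → q < m → ρ q + sft < ℓ
      shared-position<ℓ {sft} {q} sft≤s q<m = subst (ρ q + sft <_) m+s≡ℓ (+-mono-<-≤ (ρ<m q<m) sft≤s)

      shared₀-increasing : Increasing (shared 0)
      shared₀-increasing {q} {q′} q<q′ q′<m =
        subst₂ (λ x y → p ! x < p ! y) (sym (+-identityʳ (ρ q))) (sym (+-identityʳ (ρ q′)))
          (subst₂ (λ x y → at p x < at p y) (σℕ-suc (<-trans q<q′ q′<m)) (σℕ-suc q′<m)
            (sorts (suc q) (suc q′) (s≤s z≤n) (s≤s q<q′) q′<m))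

      sharedₛ-increasing : Increasing (shared s)
      sharedₛ-increasing {q} {q′} q<q′ q′<m with w , _ , _ , wins ← extension-word =
        shared-order {w} wins (ρ<m (<-trans q<q′ q′<m)) (ρ<m q′<m)
          (subst₂ _<_ (cong (p !_) (+-identityʳ (ρ q))) (cong (p !_) (+-identityʳ (ρ q′)))
            (shared₀-increasing q<q′ q′<m))

      m≡1+ℓ∸i : m ≡ suc (ℓ ∸ i)
      m≡1+ℓ∸i = +-comm (ℓ ∸ i) 1

      ℓ∸i<m : ℓ ∸ i < m
      ℓ∸i<m = subst (ℓ ∸ i <_) (sym m≡1+ℓ∸i) (n<1+n (ℓ ∸ i))

      δ-first : ∀ sft → δ p i σ sft 1 ≡ ℤ.+ shared sft 0 ℤ.- ℤ.+ 1
      δ-first sft = cong (λ r → ℤ.+ at p (r + sft) ℤ.- ℤ.+ 1) (σℕ-suc 1≤m)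

      δ-middle : ∀ sft {g} → suc g < m →
                 δ p i σ sft (suc (suc g)) ≡ ℤ.+ shared sft (suc g) ℤ.- ℤ.+ shared sft g ℤ.- ℤ.+ 1
      δ-middle sft {g} 1+g<m
        rewrite dec-false (suc (suc g) ≟ m + 1) (λ eq → <⇒≢ 1+g<m (suc-injective (trans eq (+-comm m 1))))
              | σℕ-suc 1+g<m | σℕ-suc (<-trans (n<1+n g) 1+g<m) = refl

      δ-last : ∀ sft → δ p i σ sft (suc m) ≡ ℤ.+ ℓ ℤ.- ℤ.+ shared sft (ℓ ∸ i)
      δ-last sft = begin
        δ p i σ sft (suc m)                  ≡⟨ cong (δ p i σ sft) (+-comm 1 m) ⟩
        δ p i σ sft (m + 1)                  ≡⟨ unfold ⟩
        ℤ.+ ℓ ℤ.- ℤ.+ at p (σℕ σ m + sft)        ≡⟨ cong (λ r → ℤ.+ ℓ ℤ.- ℤ.+ at p (r + sft)) σℕ-m ⟩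
        ℤ.+ ℓ ℤ.- ℤ.+ shared sft (ℓ ∸ i)         ∎
        where
        open ≡-Reasoning
        σℕ-m : σℕ σ m ≡ suc (ρ (ℓ ∸ i))
        σℕ-m = trans (cong (σℕ σ) m≡1+ℓ∸i) (σℕ-suc ℓ∸i<m)
        unfold : δ p i σ sft (m + 1) ≡ ℤ.+ ℓ ℤ.- ℤ.+ at p (σℕ σ m + sft)
        unfold rewrite dec-false (m + 1 ≟ 1) (λ eq → <⇒≢ 1≤m (sym (+-cancelʳ-≡ 1 m 0 eq)))
                     | dec-true (m + 1 ≟ m + 1) refl = refl

      1≤ℓ : 1 ≤ ℓ
      1≤ℓ = ≤-trans 1≤m (<⇒≤ m<ℓ)

      Separates : (ℕ → ℕ) → ℕ → ℕ → Set
      Separates f g x = ∀ {q} → q < m → (q < g → f q < x) × (g ≤ q → x < f q)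

      separates-≢ : ∀ {f g x} → Separates f g x → ∀ {q} → q < m → f q ≢ x
      separates-≢ {g = g} sep {q} q<m fq≡x with q <? g
      ... | yes q<g = <⇒≢ (proj₁ (sep q<m) q<g) fq≡x
      ... | no q≮g = <⇒≢ (proj₂ (sep q<m) (≮⇒≥ q≮g)) (sym fq≡x)

      δ-positive⇒separator : ∀ {sft g} → sft ≤ s → Increasing (shared sft) → g ≤ m →
                             0ℤ ℤ.< δ p i σ sft (suc g) →
                             ∃[ x ] 1 ≤ x × x ≤ ℓ × Separates (shared sft) g x
      δ-positive⇒separator {sft} {zero} _ f↑ _ pos =
        1 , ≤-refl , 1≤ℓ , λ q<m → (λ ()) , λ _ → <-≤-trans gap (increasing-≤ f↑ z≤n q<m)
        where gap = 0<+m-+n⇒n<m (subst (0ℤ ℤ.<_) (δ-first sft) pos)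
      δ-positive⇒separator {sft} {suc g} sft≤s f↑ 1+g≤m pos with m≤n⇒m<n∨m≡n 1+g≤m
      ... | inj₁ 1+g<m =
        suc (shared sft g) , s≤s z≤n ,
        <⇒≤ (<-≤-trans gap (proj₂ (pattern-range (shared-position<ℓ sft≤s 1+g<m)))) ,
        λ q<m → (λ q<1+g → s≤s (increasing-≤ f↑ (≤-pred q<1+g) (<-trans (n<1+n g) 1+g<m))) ,
                (λ 1+g≤q → <-≤-trans gap (increasing-≤ f↑ 1+g≤q q<m))
        where
        gap : suc (shared sft g) < shared sft (suc g)
        gap = subst (_< shared sft (suc g)) (+-comm (shared sft g) 1) (0<+m-+n⇒n<m (subst (0ℤ ℤ.<_)
                (trans (δ-middle sft 1+g<m) (+m-+n-1≡+m-+[n+1] (shared sft (suc g)) (shared sft g))) pos))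
      ... | inj₂ 1+g≡m =
        ℓ , 1≤ℓ , ≤-refl ,
        λ {q} q<m → (λ _ → ≤-<-trans (increasing-≤ f↑ (≤-pred (subst (q <_) m≡1+ℓ∸i q<m)) ℓ∸i<m) gap) ,
                (λ 1+g≤q → contradiction (<-≤-trans q<m (subst (_≤ q) 1+g≡m 1+g≤q)) (<-irrefl refl))
        where
        gap : shared sft (ℓ ∸ i) < ℓ
        gap = 0<+m-+n⇒n<m (subst (0ℤ ℤ.<_) (δ-last sft)
                (subst (λ j → 0ℤ ℤ.< δ p i σ sft (suc j)) 1+g≡m pos))

      shared≢ : ∀ {sft q t} → sft ≤ s → q < m → t < ℓ → ρ q + sft ≢ t → shared sft q ≢ p ! t
      shared≢ sft≤s q<m t<ℓ ≢t eq = ≢t (pattern-injective (shared-position<ℓ sft≤s q<m) t<ℓ eq)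

      unshared≢ : ∀ {t} → m ≤ t → t < s → ∀ {sft q} → sft ≡ 0 ⊎ sft ≡ s → q < m → ρ q + sft ≢ t
      unshared≢ m≤t _   (inj₁ refl) q<m =
        <⇒≢ (<-≤-trans (subst (_< m) (sym (+-identityʳ _)) (ρ<m q<m)) m≤t)
      unshared≢ _   t<s {q = q} (inj₂ refl) _ eq = <⇒≢ (<-≤-trans t<s (m≤n+m s (ρ q))) (sym eq)

      Δ-first-positive : ∀ {t} → m ≤ t → t < s → p ! t ≡ 1 → 0ℤ ℤ.< Δ¹ p i σ 1
      Δ-first-positive {t} m≤t t<s pt≡1 = 0<⊓ (above (inj₁ refl) z≤n) (above (inj₂ refl) ≤-refl)
        where
        above : ∀ {sft} → sft ≡ 0 ⊎ sft ≡ s → sft ≤ s → 0ℤ ℤ.< δ p i σ sft 1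
        above {sft} which sft≤s = subst (0ℤ ℤ.<_) (sym (δ-first sft)) (n<m⇒0<+m-+n
          (≤∧≢⇒< (proj₁ (pattern-range (shared-position<ℓ sft≤s 1≤m)))
            λ 1≡ → shared≢ sft≤s 1≤m (<-trans t<s s<ℓ) (unshared≢ m≤t t<s which 1≤m)
                     (trans (sym 1≡) (sym pt≡1))))

      Δ-last-positive : ∀ {t} → m ≤ t → t < s → p ! t ≡ ℓ → 0ℤ ℤ.< Δ¹ p i σ (suc m)
      Δ-last-positive {t} m≤t t<s pt≡ℓ = 0<⊓ (below (inj₁ refl) z≤n) (below (inj₂ refl) ≤-refl)
        where
        below : ∀ {sft} → sft ≡ 0 ⊎ sft ≡ s → sft ≤ s → 0ℤ ℤ.< δ p i σ sft (suc m)
        below {sft} which sft≤s = subst (0ℤ ℤ.<_) (sym (δ-last sft)) (n<m⇒0<+m-+n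
          (≤∧≢⇒< (proj₂ (pattern-range (shared-position<ℓ sft≤s ℓ∸i<m)))
            λ ≡ℓ → shared≢ sft≤s ℓ∸i<m (<-trans t<s s<ℓ) (unshared≢ m≤t t<s which ℓ∸i<m)
                     (trans ≡ℓ (sym pt≡ℓ))))

      separators⇒tie-pair : ∀ {g a b′} → a < ℓ →
        Separates (shared s) g (p ! a) → Separates (shared 0) g (p ! b′) →
        a < s × (∀ {t} → t < m → SameSide (p ! (t + s)) (p ! t) (p ! a) (p ! b′))
      separators⇒tie-pair {g} {a} {b′} a<ℓ sepₐ sep_b = a<s , same-side
        where
        a<s : a < s
        a<s = ≰⇒> λ s≤a →
          let t<m = subst (a ∸ s <_) (trans (cong (_∸ s) (sym m+s≡ℓ)) (m+n∸n≡m m s)) (∸-monoˡ-< a<ℓ s≤a)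
              q , q<m , ρq≡t = ρ-surjective t<m
          in separates-≢ sepₐ q<m (cong (p !_) (trans (cong (_+ s) ρq≡t) (m∸n+n≡m s≤a)))
        same-side : ∀ {t} → t < m → SameSide (p ! (t + s)) (p ! t) (p ! a) (p ! b′)
        same-side t<m with q , q<m , refl ← ρ-surjective t<m with q <? g
        ... | yes q<g = inj₁ (proj₁ (sepₐ q<m) q<g ,
                              subst (λ r → p ! r < p ! b′) (+-identityʳ (ρ q)) (proj₁ (sep_b q<m) q<g))
        ... | no q≮g = inj₂ (proj₂ (sepₐ q<m) g≤q ,
                             subst (λ r → p ! b′ < p ! r) (+-identityʳ (ρ q)) (proj₂ (sep_b q<m) g≤q))
          where g≤q = ≮⇒≥ q≮g

      Δ-positive⇒tie-pair : ∀ {g} → g ≤ m → 0ℤ ℤ.< Δ¹ p i σ (suc g) →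
        ∃₂ λ a b′ → a < s × b′ < ℓ × (∀ {t} → t < m → SameSide (p ! (t + s)) (p ! t) (p ! a) (p ! b′))
      Δ-positive⇒tie-pair {g} g≤m pos
        with pos₀ , posₛ ← 0<⊓⇒ pos
        with xₐ , 1≤xₐ , xₐ≤ℓ , sepₐ ← δ-positive⇒separator ≤-refl sharedₛ-increasing g≤m posₛ
        with x_b , 1≤x_b , x_b≤ℓ , sep_b ← δ-positive⇒separator z≤n shared₀-increasing g≤m pos₀
        with a , a<ℓ , refl ← pattern-surjective 1≤xₐ xₐ≤ℓ
        with b′ , b′<ℓ , refl ← pattern-surjective 1≤x_b x_b≤ℓ
        with a<s , same-side ← separators⇒tie-pair a<ℓ sepₐ sep_b =
        a , b′ , a<s , b′<ℓ , same-side

      Δ-positive⇒tie-word : ∀ {g} → g ≤ m → 0ℤ ℤ.< Δ¹ p i σ (suc g) → ∃[ W ] TieWord W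
      Δ-positive⇒tie-word g≤m pos
        with a , b′ , a<s , b′<ℓ , same-side ← Δ-positive⇒tie-pair g≤m pos
        with W , len , W-pos , wins , tie ← tie-word a<s b′<ℓ same-side
        with occ₀ , occₛ ← windows⇒occurs len wins =
        W , len , W-pos , occurs⇒occurrences≡2 len W-pos occ₀ occₛ ,
        a , s + b′ , <-≤-trans a<s (m≤m+n s b′) , subst (s + b′ <_) (sym len) (shift-< b′<ℓ) , tie

      repeated-1⇒Δ-first-positive : ∀ {n v} → length v ≡ ℓ + s → All (Letter n) v → 2 ≤ count 1 v →
                                    occurrences p v ≡ 2 → 0ℤ ℤ.< Δ¹ p i σ 1
      repeated-1⇒Δ-first-positive len letters repeated two =
        let t , m≤t , t<s , pt≡1 = repeated-extremal-letter _≤_ ordered-minimum len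
                                     (All.map proj₁ letters) two repeated
                                     (λ k< → All-! (All.map proj₁ letters) (subst (_ <_) (sym len) k<))
        in Δ-first-positive m≤t t<s pt≡1

      repeated-n⇒Δ-last-positive : ∀ {n v} → length v ≡ ℓ + s → All (Letter n) v → 2 ≤ count n v →
                                   occurrences p v ≡ 2 → 0ℤ ℤ.< Δ¹ p i σ (suc m)
      repeated-n⇒Δ-last-positive len letters repeated two =
        let t , m≤t , t<s , pt≡ℓ = repeated-extremal-letter (λ a b → b ≤ a) ordered-maximum len
                                     (All.map proj₁ letters) two repeated
                                     (λ k< → All-! (All.map proj₂ letters) (subst (_ <_) (sym len) k<))
        in Δ-last-positive m≤t t<s pt≡ℓ

      forbidden-letter : ∀ {n} g →
        (∀ j′ → 1 ≤ j′ → j′ ≤ ℓ ∸ i + 2 → j′ ≢ suc g → ¬ (0ℤ ℤ.< Δ¹ p i σ j′)) →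
        1 ≤ n → Σ (Fin n) λ e → ∀ v → length v ≡ ℓ + s → All (Letter n) v → 2 ≤ count (letter e) v →
                                     occurrences p v ≢ 2
      forbidden-letter {n} zero only 1≤n = letter⁻¹ n-letter , λ v len letters repeated two →
        only (suc m) (s≤s z≤n) (≤-reflexive (sym (+-suc (ℓ ∸ i) 1)))
          (λ 1+m≡1 → <⇒≢ 1≤m (sym (suc-injective 1+m≡1)))
          (repeated-n⇒Δ-last-positive len letters
            (subst (λ x → 2 ≤ count x v) (letter-letter⁻¹ n-letter) repeated) two)
        where
        n-letter : Letter n n
        n-letter = 1≤n , ≤-refl
      forbidden-letter {n} (suc g) only 1≤n = letter⁻¹ 1-letter , λ v len letters repeated two →
        only 1 ≤-refl (≤-trans (s≤s z≤n) (m≤n+m 2 (ℓ ∸ i))) (λ ())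
          (repeated-1⇒Δ-first-positive len letters
            (subst (λ x → 2 ≤ count x v) (letter-letter⁻¹ 1-letter) repeated) two)
        where
        1-letter : Letter n 1
        1-letter = ≤-refl , 1≤n

lemma4p13 : (p : List ℕ) → p ↭ map suc (upTo (length p)) →
    (i : ℕ) → MinExtendable p i →
    (σ : Permutation′ (length p ∸ i + 1)) → Sorts p i σ →
    ExactlyOnePositive p i σ →
    Σ ℕ λ n → Σ (Fin n → ℕ) λ k → Σ (Permutation′ n) λ τ →
      cardMstar k p 2 ≢ cardMstar (λ j → k (τ ⟨$⟩ˡ j)) p 2
lemma4p13 p p↭ i min-ext σ sorts (suc g , _ , 1+g≤ , Δ-positive , only-positive) =
  let open Pattern p p↭
      open Overlap i min-ext
      open Ranks σ sorts
      W , W-length , W-positive , W-occurrences , u , u′ , u<u′ , u′<W , tie =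
        Δ-positive⇒tie-word (s≤s⁻¹ (subst (suc g ≤_) (+-suc (ℓ ∸ i) 1) 1+g≤)) Δ-positive
      k = multiplicities W
      W-permutation = multiplicities-permutation W-positive
      c , 2≤kc = repeated-multiplicity W-positive u<u′ u′<W tie
      e , forbidden = forbidden-letter g only-positive
                        (≤-trans (All-! W-positive u′<W) (All-! (xs≤max 0 W) u′<W))
      size≡ = trans (sym (length-permutation W-permutation)) W-length
  in max 0 W , k , transpose e c , λ same →
       <⇒≢ (cardMstar-pos k p 2 W-permutation W-occurrences)
         (sym (trans same (cardMstar-transpose≡0 k p 2 e c 2≤kc λ v len → forbidden v (trans len size≡))))
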